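{- Let $k,m,n$ be non-negative integers such that $n \ge k \ge 5$, $m \ge b_k$ and $2^m \ge m - b_k + \nu_2(k!)$. Then $S([n]_{2^m},k)=\{S(j,k): j\in[n]_{2^m}\}$ is constant modulo $2^{m-b_k}$, i.e. all its elements are congruent to one another modulo $2^{m-b_k}$.
   Context: $S(n,k)$ denotes the Stirling number of the second kind. $\nu_2(z)$ is the exponent of the largest power of $2$ dividing the positive integer $z$. $b_k = \lceil \log_2 k\rceil - 2$. For $n,t\in\mathbb{N}$, $[n]_t = \{ j \in \mathbb{N} : j \ge \max\{n,t\},\ j \equiv n \pmod t\}$. -}

module Defs where

open import Data.Nat using (ℕ; zero; suc; _+_; _*_; _∸_; _^_; _≤_; _≥_; NonZero)
open import Data.Nat.Properties using (m^n≢0)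
open import Data.Nat.DivMod using (_%_)
open import Data.Nat.Divisibility using (_∣_)
open import Data.Nat.Logarithm using (⌈log₂_⌉)

open import Data.Product using (_×_; ∃-syntax)
open import Relation.Nullary using (¬_)
open import Relation.Binary.PropositionalEquality using (_≡_)

S : ℕ → ℕ → ℕ
S zero    zero    = 1
S zero    (suc k) = 0
S (suc n) zero    = 0
S (suc n) (suc k) = suc k * S n (suc k) + S n k

IsNu2 : ℕ → ℕ → Set
IsNu2 z v = (2 ^ v ∣ z) × ¬ (2 ^ suc v ∣ z)

-- b_k = ⌈log₂ k⌉ - 2 (truncated subtraction; only used for k ≥ 5 where it is ≥ 1)
b : ℕ → ℕ
b k = ⌈log₂ k ⌉ ∸ 2

InClass : ℕ → (t : ℕ) → .{{NonZero t}} → ℕ → Set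
InClass n t j = (j ≥ n) × (j ≥ t) × (j % t ≡ n % t)

_≡_[mod2^_] : ℕ → ℕ → ℕ → Set
x ≡ y [mod2^ e ] = x % (2 ^ e) ≡ y % (2 ^ e)
  where instance _ = m^n≢0 2 e

-- The sequence l ↦ S(l+1, k) is annihilated by (E − 1)(E − 2)⋯(E − k), E the shift operator.
-- Modulo 2 this operator is E^⌊k/2⌋ (E − 1)^⌈k/2⌉, and (E − 1)^(2^t) ≡ E^(2^t) − 1; hence once
-- ⌈k/2⌉ ≤ 2^t, every sequence in the kernel is 2^t-periodic modulo 2 from ⌊k/2⌋ on. The kernel is
-- closed under shifts, differences and exact division by constants, so a difference sequence
-- f(x+T) − f(x) divisible by 2^e can be divided by 2^e and the periodicity modulo 2 applied to the
-- quotient: doubling the period gains a factor 2 in the modulus and raises the threshold by ⌊k/2⌋.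
-- With t = b_k + 1 and d + 1 = m − b_k steps, the period is 2^m and the modulus 2^(m − b_k); the
-- hypothesis on ν₂(k!) keeps the threshold (d+1)⌊k/2⌋ below 2^m.
module Submission where

open import Defs
open import Data.Empty using (⊥-elim)
open import Data.Integer.Base using (ℤ; +_; -_; 0ℤ; ∣_∣)
  renaming (_+_ to _+ᶻ_; _-_ to _-ᶻ_; _*_ to _*ᶻ_)
open import Data.Integer.Divisibility.Signed
  using (divides; ∣m∣n⇒∣m+n; ∣m⇒∣-m; ∣n⇒∣m*n; *-monoˡ-∣; *-monoʳ-∣; ∣⇒∣ᵤ)
  renaming (_∣_ to _∣ᶻ_)
import Data.Integer.Properties as ℤ
open import Data.Integer.Tactic.RingSolver using (solve-∀)
open import Data.Nat
  using (ℕ; zero; suc; _+_; _∸_; _*_; _^_; _!; _≤_; _≥_; _<_; z≤n; s≤s; NonZero; >-nonZero;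
         ⌊_/2⌋; ⌈_/2⌉)
open import Data.Nat.DivMod
  using (_%_; _/_; m≡m%n+[m/n]*n; /-monoˡ-≤; %-congˡ; %-remove-+ʳ; n%1≡0)
open import Data.Nat.Divisibility using (_∣_)
import Data.Nat.Divisibility as ℕ
open import Data.Nat.Induction using (Acc; acc)
open import Data.Nat.Logarithm using (⌈log₂_⌉)
open import Data.Nat.Logarithm.Core using (⌈log2⌉)
open import Data.Nat.Properties
  using (+-identityʳ; +-suc; +-assoc; +-comm; *-comm; *-distribʳ-+; *-distribʳ-∸; ^-distribˡ-+-*;
         m^n≢0; m^n>0; ≤-reflexive; ≤-trans; ≤-antisym; ≤-total; <-≤-trans; <⇒≱; ≮⇒≥;
         m≤n⇒m<n∨m≡n; m≤m+n; m≤n+m; m+[n∸m]≡n; m∸n+n≡m; m+n≤o⇒m≤o∸n; m+n≤o⇒n≤o; +-∸-assoc;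
         +-mono-≤; +-monoˡ-≤; +-monoʳ-≤; +-monoʳ-<; *-monoˡ-≤; *-monoʳ-≤; *-monoˡ-<; *-monoʳ-<;
         ⌊n/2⌋≤⌈n/2⌉; ⌊n/2⌋+⌈n/2⌉≡n; ⌈n/2⌉<n; ⌈n/2⌉-mono; n≡⌈n+n/2⌉; module ≤-Reasoning)
import Data.Nat.Tactic.RingSolver as ℕ-Solver
open import Data.Product using (_,_)
open import Data.Sum using (inj₁; inj₂)
open import Level using (0ℓ)
open import Relation.Binary.Bundles using (Setoid)
open import Relation.Binary.PropositionalEquality
  using (_≡_; _≗_; refl; sym; trans; cong; cong₂; subst; subst₂; module ≡-Reasoning)

infix 4 _≡_[mod_]

record _≡_[mod_] (x y : ℤ) (n : ℕ) : Set where
  constructor mod-by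
  field divides-difference : + n ∣ᶻ x -ᶻ y

open _≡_[mod_]

module _ {n : ℕ} where

  ≡⇒≡-mod : ∀ {x y} → x ≡ y → x ≡ y [mod n ]
  ≡⇒≡-mod {x} refl = mod-by (divides 0ℤ (ℤ.+-inverseʳ x))

  mod-sym : ∀ {x y} → x ≡ y [mod n ] → y ≡ x [mod n ]
  mod-sym {x} {y} (mod-by p) = mod-by (subst (+ n ∣ᶻ_) (negate x y) (∣m⇒∣-m p))
    where
    negate : ∀ x y → - (x -ᶻ y) ≡ y -ᶻ x
    negate = solve-∀

  mod-trans : ∀ {x y z} → x ≡ y [mod n ] → y ≡ z [mod n ] → x ≡ z [mod n ]
  mod-trans {x} {y} {z} (mod-by p) (mod-by q) =
    mod-by (subst (+ n ∣ᶻ_) (telescope x y z) (∣m∣n⇒∣m+n p q))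
    where
    telescope : ∀ x y z → (x -ᶻ y) +ᶻ (y -ᶻ z) ≡ x -ᶻ z
    telescope = solve-∀

  mod-- : ∀ {x x′ y y′} → x ≡ x′ [mod n ] → y ≡ y′ [mod n ] → x -ᶻ y ≡ x′ -ᶻ y′ [mod n ]
  mod-- {x} {x′} {y} {y′} (mod-by p) (mod-by q) =
    mod-by (subst (+ n ∣ᶻ_) (regroup x x′ y y′) (∣m∣n⇒∣m+n p (∣m⇒∣-m q)))
    where
    regroup : ∀ x x′ y y′ → (x -ᶻ x′) +ᶻ - (y -ᶻ y′) ≡ (x -ᶻ y) -ᶻ (x′ -ᶻ y′)
    regroup = solve-∀

  mod-* : ∀ {x x′ y y′} → x ≡ x′ [mod n ] → y ≡ y′ [mod n ] → x *ᶻ y ≡ x′ *ᶻ y′ [mod n ]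
  mod-* {x} {x′} {y} {y′} (mod-by p) (mod-by q) =
    mod-by (subst (+ n ∣ᶻ_) (regroup x x′ y y′) (∣m∣n⇒∣m+n (∣n⇒∣m*n y p) (∣n⇒∣m*n x′ q)))
    where
    regroup : ∀ x x′ y y′ → y *ᶻ (x -ᶻ x′) +ᶻ x′ *ᶻ (y -ᶻ y′) ≡ x *ᶻ y -ᶻ x′ *ᶻ y′
    regroup = solve-∀

  difference≡0⇒≡ : ∀ {x y} → x -ᶻ y ≡ 0ℤ [mod n ] → x ≡ y [mod n ]
  difference≡0⇒≡ {x} {y} (mod-by p) = mod-by (subst (+ n ∣ᶻ_) (ℤ.+-identityʳ (x -ᶻ y)) p)

  mod-setoid : Setoid 0ℓ 0ℓ
  mod-setoid = record
    { Carrier       = ℤ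
    ; _≈_           = _≡_[mod n ]
    ; isEquivalence = record { refl = ≡⇒≡-mod refl ; sym = mod-sym ; trans = mod-trans }
    }

mod-*-scale : ∀ {x y p} N → x ≡ y [mod p ] → x *ᶻ + N ≡ y *ᶻ + N [mod p * N ]
mod-*-scale {x} {y} {p} N (mod-by p∣x-y) =
  mod-by (subst₂ _∣ᶻ_ (sym (ℤ.pos-* p N)) (factor x y (+ N)) (*-monoˡ-∣ (+ N) p∣x-y))
  where
  factor : ∀ x y n → (x -ᶻ y) *ᶻ n ≡ x *ᶻ n -ᶻ y *ᶻ n
  factor = solve-∀

Sequence : Set
Sequence = ℕ → ℤ

shift : ℕ → Sequence → Sequence
shift J f l = f (l + J)

[E-_] : ℤ → Sequence → Sequence
[E- c ] f l = f (suc l) -ᶻ c *ᶻ f l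

-- ∏[E- c ] k is the operator (E − c 1) ⋯ (E − c k), E being the shift; E − c k acts first.
∏[E-_] : (ℕ → ℤ) → ℕ → Sequence → Sequence
∏[E- c ] zero    f = f
∏[E- c ] (suc k) f = ∏[E- c ] k ([E- c (suc k) ] f)

module _ (c : ℕ → ℤ) where

  ∏-cong : ∀ k {f g} → f ≗ g → ∏[E- c ] k f ≗ ∏[E- c ] k g
  ∏-cong zero    f≗g = f≗g
  ∏-cong (suc k) f≗g =
    ∏-cong k (λ l → cong₂ (λ x y → x -ᶻ c (suc k) *ᶻ y) (f≗g (suc l)) (f≗g l))

  ∏-shift : ∀ k J f → ∏[E- c ] k (shift J f) ≗ shift J (∏[E- c ] k f)
  ∏-shift zero    J f l = refl
  ∏-shift (suc k) J f   = ∏-shift k J ([E- c (suc k) ] f)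

  ∏-sub : ∀ k f g → ∏[E- c ] k (λ l → f l -ᶻ g l) ≗ λ l → ∏[E- c ] k f l -ᶻ ∏[E- c ] k g l
  ∏-sub zero    f g l = refl
  ∏-sub (suc k) f g l = trans
    (∏-cong k (λ l → regroup (f (suc l)) (g (suc l)) (f l) (g l) (c (suc k))) l)
    (∏-sub k ([E- c (suc k) ] f) ([E- c (suc k) ] g) l)
    where
    regroup : ∀ a b x y z → a -ᶻ b -ᶻ z *ᶻ (x -ᶻ y) ≡ (a -ᶻ z *ᶻ x) -ᶻ (b -ᶻ z *ᶻ y)
    regroup = solve-∀

  ∏-scale : ∀ k f q → ∏[E- c ] k (λ l → f l *ᶻ q) ≗ λ l → ∏[E- c ] k f l *ᶻ q
  ∏-scale zero    f q l = refl
  ∏-scale (suc k) f q l = trans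
    (∏-cong k (λ l → factor (f (suc l)) (f l) (c (suc k)) q) l)
    (∏-scale k ([E- c (suc k) ] f) q l)
    where
    factor : ∀ a x z q → a *ᶻ q -ᶻ z *ᶻ (x *ᶻ q) ≡ (a -ᶻ z *ᶻ x) *ᶻ q
    factor = solve-∀

  ∏-zero : ∀ k l → ∏[E- c ] k (λ _ → 0ℤ) l ≡ 0ℤ
  ∏-zero zero    l = refl
  ∏-zero (suc k) l = trans (∏-cong k (λ _ → cong (0ℤ -ᶻ_) (ℤ.*-zeroʳ (c (suc k)))) l) (∏-zero k l)

∏-cong-mod : ∀ {n c c′} → (∀ i → c i ≡ c′ i [mod n ]) →
             ∀ k {f g} → (∀ l → f l ≡ g l [mod n ]) →
             ∀ l → ∏[E- c ] k f l ≡ ∏[E- c′ ] k g l [mod n ]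
∏-cong-mod c≡c′ zero    f≡g = f≡g
∏-cong-mod c≡c′ (suc k) f≡g =
  ∏-cong-mod c≡c′ k (λ l → mod-- (f≡g (suc l)) (mod-* (c≡c′ (suc k)) (f≡g l)))

record Annihilated (k : ℕ) (f : Sequence) : Set where
  constructor annihilated
  field annihilates : ∀ l → ∏[E- +_ ] k f l ≡ 0ℤ

open Annihilated

-- S(l, k) is annihilated only from l = 1 on (its closed form has a term 0^l), hence the shift.
stirling : ℕ → Sequence
stirling k l = + S (suc l) k

stirling-recurrence : ∀ k → [E- + suc k ] (stirling (suc k)) ≗ stirling k
stirling-recurrence k l = begin
    + (suc k * X + Y) -ᶻ + suc k *ᶻ + X
  ≡⟨ cong (_-ᶻ + suc k *ᶻ + X)
          (trans (ℤ.pos-+ (suc k * X) Y) (cong (_+ᶻ + Y) (ℤ.pos-* (suc k) X))) ⟩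
    (+ suc k *ᶻ + X +ᶻ + Y) -ᶻ + suc k *ᶻ + X
  ≡⟨ cancel (+ suc k *ᶻ + X) (+ Y) ⟩
    + Y ∎
  where
  open ≡-Reasoning
  X = S (suc l) (suc k)
  Y = S (suc l) k
  cancel : ∀ u y → (u +ᶻ y) -ᶻ u ≡ y
  cancel = solve-∀

stirling-annihilated : ∀ k → Annihilated k (stirling k)
stirling-annihilated zero    = annihilated λ _ → refl
stirling-annihilated (suc k) = annihilated λ l →
  trans (∏-cong +_ k (stirling-recurrence k) l) (annihilates (stirling-annihilated k) l)

annihilated-shift : ∀ {k f} J → Annihilated k f → Annihilated k (shift J f)
annihilated-shift {k} {f} J ann = annihilated λ l →
  trans (∏-shift +_ k J f l) (annihilates ann (l + J))

annihilated-sub : ∀ {k f g} → Annihilated k f → Annihilated k g → Annihilated k (λ l → f l -ᶻ g l)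
annihilated-sub {k} {f} {g} annf anng = annihilated λ l →
  trans (∏-sub +_ k f g l) (cong₂ _-ᶻ_ (annihilates annf l) (annihilates anng l))

annihilated-quotient : ∀ {k g w} N .{{_ : NonZero N}} →
                       Annihilated k g → (∀ l → g l ≡ w l *ᶻ + N) → Annihilated k w
annihilated-quotient {k} {g} {w} N ann g≡wN = annihilated λ l → ℤ.*-cancelʳ-≡ _ 0ℤ (+ N) (begin
    ∏[E- +_ ] k w l *ᶻ + N
  ≡⟨ ∏-scale +_ k w (+ N) l ⟨
    ∏[E- +_ ] k (λ l → w l *ᶻ + N) l
  ≡⟨ ∏-cong +_ k g≡wN l ⟨
    ∏[E- +_ ] k g l
  ≡⟨ annihilates ann l ⟩
    0ℤ ∎)
  where open ≡-Reasoning

Δ^ : ℕ → Sequence → Sequence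
Δ^ = ∏[E- (λ _ → + 1) ]

Δ[_] : ℕ → Sequence → Sequence
Δ[ T ] h l = h (l + T) -ᶻ h l

Δ^-+ : ∀ r o h → Δ^ (r + o) h ≗ Δ^ o (Δ^ r h)
Δ^-+ zero    o h l = refl
Δ^-+ (suc r) o h   = Δ^-+ r o ([E- + 1 ] h)

parity : ℕ → ℤ
parity zero          = 0ℤ
parity (suc zero)    = + 1
parity (suc (suc i)) = parity i

parity≡ : ∀ i → parity i ≡ + i [mod 2 ]
parity≡ zero          = ≡⇒≡-mod refl
parity≡ (suc zero)    = ≡⇒≡-mod refl
parity≡ (suc (suc i)) = mod-trans (parity≡ i) (mod-by (divides (- + 1) (begin
    + i -ᶻ + (2 + i)   ≡⟨ cong (+ i -ᶻ_) (ℤ.pos-+ 2 i) ⟩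
    + i -ᶻ (+ 2 +ᶻ + i) ≡⟨ difference (+ i) ⟩
    - + 1 *ᶻ + 2       ∎)))
  where
  open ≡-Reasoning
  difference : ∀ x → x -ᶻ (+ 2 +ᶻ x) ≡ - + 1 *ᶻ + 2
  difference = solve-∀

parity-pair : ∀ k f → [E- parity (suc k) ] ([E- parity k ] f) ≗ [E- + 1 ] ([E- 0ℤ ] f)
parity-pair zero          f l = refl
parity-pair (suc zero)    f l = commute (f (suc (suc l))) (f (suc l)) (f l)
  where
  commute : ∀ a b c → (a -ᶻ + 1 *ᶻ b) -ᶻ 0ℤ *ᶻ (b -ᶻ + 1 *ᶻ c)
                    ≡ (a -ᶻ 0ℤ *ᶻ b) -ᶻ + 1 *ᶻ (b -ᶻ 0ℤ *ᶻ c)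
  commute = solve-∀
parity-pair (suc (suc k)) f = parity-pair k f

∏-parity : ∀ k f → ∏[E- parity ] k f ≗ Δ^ ⌈ k /2⌉ (shift ⌊ k /2⌋ f)
∏-parity zero          f l = cong f (sym (+-identityʳ l))
∏-parity (suc zero)    f l =
  cong₂ (λ a b → f a -ᶻ + 1 *ᶻ f b) (cong suc (sym (+-identityʳ l))) (sym (+-identityʳ l))
∏-parity (suc (suc k)) f l = begin
    ∏[E- parity ] k ([E- parity (suc k) ] ([E- parity k ] f)) l
  ≡⟨ ∏-cong parity k (parity-pair k f) l ⟩
    ∏[E- parity ] k ([E- + 1 ] ([E- 0ℤ ] f)) l
  ≡⟨ ∏-parity k ([E- + 1 ] ([E- 0ℤ ] f)) l ⟩
    Δ^ ⌈ k /2⌉ ([E- + 1 ] (shift a ([E- 0ℤ ] f))) l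
  ≡⟨ ∏-cong _ ⌈ k /2⌉ (λ l → cong₂ (λ x y → x -ᶻ + 1 *ᶻ y) (E-shift (suc l)) (E-shift l)) l ⟩
    Δ^ ⌈ k /2⌉ ([E- + 1 ] (shift (suc a) f)) l ∎
  where
  open ≡-Reasoning
  a = ⌊ k /2⌋
  E-shift : shift a ([E- 0ℤ ] f) ≗ shift (suc a) f
  E-shift l = trans (ℤ.+-identityʳ _) (cong f (sym (+-suc l a)))

2^[1+n]≡2^n+2^n : ∀ n → 2 ^ suc n ≡ 2 ^ n + 2 ^ n
2^[1+n]≡2^n+2^n n = cong (λ x → 2 ^ n + x) (+-identityʳ (2 ^ n))

second-difference-mod2 : ∀ a b c → (a -ᶻ b) -ᶻ (b -ᶻ c) ≡ a -ᶻ c [mod 2 ]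
second-difference-mod2 a b c = mod-by (divides (c -ᶻ b) (expand a b c))
  where
  expand : ∀ a b c → (a -ᶻ b) -ᶻ (b -ᶻ c) -ᶻ (a -ᶻ c) ≡ (c -ᶻ b) *ᶻ + 2
  expand = solve-∀

Δ^2^t≡Δ[2^t] : ∀ t h l → Δ^ (2 ^ t) h l ≡ Δ[ 2 ^ t ] h l [mod 2 ]
Δ^2^t≡Δ[2^t] zero    h l = ≡⇒≡-mod (cong₂ (λ x y → h x -ᶻ y) (+-comm 1 l) (ℤ.*-identityˡ (h l)))
Δ^2^t≡Δ[2^t] (suc t) h l = begin
    Δ^ (2 ^ suc t) h l            ≡⟨ cong (λ r → Δ^ r h l) (2^[1+n]≡2^n+2^n t) ⟩
    Δ^ (T + T) h l                ≡⟨ Δ^-+ T T h l ⟩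
    Δ^ T (Δ^ T h) l               ≈⟨ ∏-cong-mod (λ _ → ≡⇒≡-mod refl) T (Δ^2^t≡Δ[2^t] t h) l ⟩
    Δ^ T (Δ[ T ] h) l             ≈⟨ Δ^2^t≡Δ[2^t] t (Δ[ T ] h) l ⟩
    Δ[ T ] (Δ[ T ] h) l           ≈⟨ second-difference-mod2 (h (l + T + T)) (h (l + T)) (h l) ⟩
    h (l + T + T) -ᶻ h l          ≡⟨ cong (λ x → h x -ᶻ h l) l+T+T≡l+2^[1+t] ⟩
    Δ[ 2 ^ suc t ] h l            ∎
  where
  open import Relation.Binary.Reasoning.Setoid (mod-setoid {2})
  T = 2 ^ t
  l+T+T≡l+2^[1+t] : l + T + T ≡ l + 2 ^ suc t
  l+T+T≡l+2^[1+t] = trans (+-assoc l T T) (cong (λ x → l + x) (sym (2^[1+n]≡2^n+2^n t)))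

PeriodicFrom : ℕ → ℕ → ℕ → Sequence → Set
PeriodicFrom J T n f = ∀ x → J ≤ x → f (x + T) ≡ f x [mod n ]

KernelPeriodic : ℕ → ℕ → ℕ → ℕ → Set
KernelPeriodic k J T n = ∀ f → Annihilated k f → PeriodicFrom J T n f

periodicFrom-unshift : ∀ {J J₁ T n f} →
                       PeriodicFrom J T n (shift J₁ f) → PeriodicFrom (J + J₁) T n f
periodicFrom-unshift {J} {J₁} {T} {n} {f} per x J+J₁≤x =
  subst₂ (λ u v → f u ≡ f v [mod n ])
    (trans (reorder y T J₁) (cong (_+ T) y+J₁≡x)) y+J₁≡x
    (per y (m+n≤o⇒m≤o∸n J J+J₁≤x))
  where
  y = x ∸ J₁
  y+J₁≡x : y + J₁ ≡ x
  y+J₁≡x = m∸n+n≡m (m+n≤o⇒n≤o J J+J₁≤x)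
  reorder : ∀ y T J₁ → y + T + J₁ ≡ y + J₁ + T
  reorder = ℕ-Solver.solve-∀

periodicFrom-* : ∀ {J T n f} → PeriodicFrom J T n f → ∀ q → PeriodicFrom J (q * T) n f
periodicFrom-* {J} {T} {n} {f} per zero    x J≤x = ≡⇒≡-mod (cong f (+-identityʳ x))
periodicFrom-* {J} {T} {n} {f} per (suc q) x J≤x = mod-trans
  (subst (λ u → f u ≡ f (x + T) [mod n ]) (+-assoc x T (q * T))
    (periodicFrom-* per q (x + T) (≤-trans J≤x (m≤m+n x T))))
  (per x J≤x)

periodicFrom-divisible : ∀ {k J T p g} N .{{_ : NonZero N}} → KernelPeriodic k J T p →
                         Annihilated k g → (∀ y → + N ∣ᶻ g y) → PeriodicFrom J T (p * N) g
periodicFrom-divisible {g = g} N per ann N∣g x J≤x =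
  subst₂ (λ u v → u ≡ v [mod _ ]) (sym (g≡wN (x + _))) (sym (g≡wN x))
    (mod-*-scale N (per w (annihilated-quotient N ann g≡wN) x J≤x))
  where
  w : Sequence
  w y = _∣ᶻ_.quotient (N∣g y)
  g≡wN : ∀ y → g y ≡ w y *ᶻ + N
  g≡wN y = _∣ᶻ_.equality (N∣g y)

-- f(x + 2T) − f(x) = (d(x + T) − d(x)) + 2 d(x) for d(x) = f(x + T) − f(x); beyond J₁ the values
-- of d are divisible by N, and d / N is again in the kernel, so d(x + T) ≡ d(x) modulo 2N.
kernelPeriodic-lift : ∀ {k J J₁ T N} .{{_ : NonZero N}} → KernelPeriodic k J₁ T N →
                      KernelPeriodic k J T 2 → KernelPeriodic k (J + J₁) (T + T) (2 * N)
kernelPeriodic-lift {k} {J} {J₁} {T} {N} per₁ per₂ f ann x J+J₁≤x =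
  mod-by (subst (+ (2 * N) ∣ᶻ_) (sym split)
                (∣m∣n⇒∣m+n (divides-difference d-periodic) 2d-divisible))
  where
  d : Sequence
  d y = f (y + T) -ᶻ f y
  d-periodic : d (x + T) ≡ d x [mod 2 * N ]
  d-periodic = periodicFrom-unshift {T = T} {f = d}
    (periodicFrom-divisible N per₂
      (annihilated-shift J₁ (annihilated-sub (annihilated-shift T ann) ann))
      (λ y → divides-difference (per₁ f ann (y + J₁) (m≤n+m J₁ y))))
    x J+J₁≤x
  2d-divisible : + (2 * N) ∣ᶻ + 2 *ᶻ d x
  2d-divisible = subst (_∣ᶻ _) (sym (ℤ.pos-* 2 N))
    (*-monoʳ-∣ (+ 2) (divides-difference (per₁ f ann x (m+n≤o⇒n≤o J J+J₁≤x))))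
  regroup : ∀ a b c → a -ᶻ c ≡ ((a -ᶻ b) -ᶻ (b -ᶻ c)) +ᶻ + 2 *ᶻ (b -ᶻ c)
  regroup = solve-∀
  split : f (x + (T + T)) -ᶻ f x ≡ (d (x + T) -ᶻ d x) +ᶻ + 2 *ᶻ d x
  split = trans (cong (λ u → f u -ᶻ f x) (sym (+-assoc x T T)))
                (regroup (f (x + T + T)) (f (x + T)) (f x))

-- Modulo 2 the kernel operator is E^⌊k/2⌋ (E − 1)^⌈k/2⌉, which divides E^⌊k/2⌋ (E^(2^t) − 1).
kernelPeriodic-mod2 : ∀ k t → ⌈ k /2⌉ ≤ 2 ^ t → KernelPeriodic k ⌊ k /2⌋ (2 ^ t) 2
kernelPeriodic-mod2 k t o≤2^t f ann = periodicFrom-unshift {J = 0} λ l _ →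
  difference≡0⇒≡ (mod-trans (mod-sym (Δ^2^t≡Δ[2^t] t h l)) (Δ^2^t≡0 l))
  where
  open import Relation.Binary.Reasoning.Setoid (mod-setoid {2})
  o = ⌈ k /2⌉
  h = shift ⌊ k /2⌋ f
  Δ^o≡0 : ∀ l → Δ^ o h l ≡ 0ℤ [mod 2 ]
  Δ^o≡0 l = begin
    Δ^ o h l              ≡⟨ ∏-parity k f l ⟨
    ∏[E- parity ] k f l   ≈⟨ ∏-cong-mod parity≡ k (λ _ → ≡⇒≡-mod refl) l ⟩
    ∏[E- +_ ] k f l       ≡⟨ annihilates ann l ⟩
    0ℤ                    ∎
  Δ^2^t≡0 : ∀ l → Δ^ (2 ^ t) h l ≡ 0ℤ [mod 2 ]
  Δ^2^t≡0 l = begin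
    Δ^ (2 ^ t) h l                      ≡⟨ cong (λ r → Δ^ r h l) (m+[n∸m]≡n o≤2^t) ⟨
    Δ^ (o + (2 ^ t ∸ o)) h l            ≡⟨ Δ^-+ o (2 ^ t ∸ o) h l ⟩
    Δ^ (2 ^ t ∸ o) (Δ^ o h) l           ≈⟨ ∏-cong-mod (λ _ → ≡⇒≡-mod refl) (2 ^ t ∸ o) Δ^o≡0 l ⟩
    Δ^ (2 ^ t ∸ o) (λ _ → 0ℤ) l         ≡⟨ ∏-zero _ (2 ^ t ∸ o) l ⟩
    0ℤ                                  ∎

kernelPeriodic-iterate : ∀ {k a T} → KernelPeriodic k a T 2 →
                         ∀ d → KernelPeriodic k (suc d * a) (2 ^ d * T) (2 ^ suc d)
kernelPeriodic-iterate {k} {a} {T} per zero =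
  subst₂ (λ J T′ → KernelPeriodic k J T′ 2) (sym (+-identityʳ a)) (sym (+-identityʳ T)) per
kernelPeriodic-iterate {k} {a} {T} per (suc d) =
  subst (λ T′ → KernelPeriodic k (suc (suc d) * a) T′ (2 ^ suc (suc d))) (sym doubled)
    (kernelPeriodic-lift {{m^n≢0 2 (suc d)}} (kernelPeriodic-iterate per d)
      (λ f ann → periodicFrom-* (per f ann) (2 ^ d)))
  where
  doubled : 2 ^ suc d * T ≡ 2 ^ d * T + 2 ^ d * T
  doubled = trans (cong (_* T) (2^[1+n]≡2^n+2^n d)) (*-distribʳ-+ T (2 ^ d) (2 ^ d))

n≡m+[n/o∸m/o]*o : ∀ {m n} o .{{_ : NonZero o}} → m ≤ n → m % o ≡ n % o → n ≡ m + (n / o ∸ m / o) * o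
n≡m+[n/o∸m/o]*o {m} {n} o m≤n m%o≡n%o = begin
    n                                             ≡⟨ m≡m%n+[m/n]*n n o ⟩
    n % o + n / o * o                             ≡⟨ cong₂ _+_ m%o≡n%o (m+[n∸m]≡n m/o*o≤n/o*o) ⟨
    m % o + (m / o * o + (n / o * o ∸ m / o * o)) ≡⟨ +-assoc (m % o) _ _ ⟨
    m % o + m / o * o + (n / o * o ∸ m / o * o)
      ≡⟨ cong₂ _+_ (m≡m%n+[m/n]*n m o) (*-distribʳ-∸ o (n / o) (m / o)) ⟨
    m + (n / o ∸ m / o) * o                       ∎
  where
  open ≡-Reasoning
  m/o*o≤n/o*o : m / o * o ≤ n / o * o
  m/o*o≤n/o*o = *-monoˡ-≤ o (/-monoˡ-≤ o m≤n)

periodicFrom-%-≤ : ∀ {J T n f} .{{_ : NonZero T}} → PeriodicFrom J T n f →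
                   ∀ {x y} → J ≤ x → x ≤ y → x % T ≡ y % T → f y ≡ f x [mod n ]
periodicFrom-%-≤ {T = T} {n} {f} per {x} {y} J≤x x≤y x%T≡y%T =
  subst (λ u → f u ≡ f x [mod n ]) (sym (n≡m+[n/o∸m/o]*o T x≤y x%T≡y%T))
    (periodicFrom-* per (y / T ∸ x / T) x J≤x)

periodicFrom-% : ∀ {J T n f} .{{_ : NonZero T}} → PeriodicFrom J T n f →
                 ∀ {x y} → J ≤ x → J ≤ y → x % T ≡ y % T → f x ≡ f y [mod n ]
periodicFrom-% per {x} {y} J≤x J≤y x%T≡y%T with ≤-total x y
... | inj₁ x≤y = mod-sym (periodicFrom-%-≤ per J≤x x≤y x%T≡y%T)
... | inj₂ y≤x = periodicFrom-%-≤ per J≤y y≤x (sym x%T≡y%T)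

stirling-periodic : ∀ {k J T n} → KernelPeriodic k J T n → PeriodicFrom (suc J) T n (λ i → + S i k)
stirling-periodic {k} per (suc x) (s≤s J≤x) = per (stirling k) (stirling-annihilated k) x J≤x

%≡%-of-mod-≤ : ∀ {a b} n .{{_ : NonZero n}} → b ≤ a → + a ≡ + b [mod n ] → a % n ≡ b % n
%≡%-of-mod-≤ {a} {b} n b≤a (mod-by n∣a-b) = begin
    a % n               ≡⟨ %-congˡ (m+[n∸m]≡n b≤a) ⟨
    (b + (a ∸ b)) % n   ≡⟨ %-remove-+ʳ b n∣a∸b ⟩
    b % n               ∎
  where
  open ≡-Reasoning
  n∣a∸b : n ∣ a ∸ b
  n∣a∸b = subst (λ z → n ∣ ∣ z ∣) (trans (ℤ.m-n≡m⊖n a b) (ℤ.⊖-≥ b≤a)) (∣⇒∣ᵤ n∣a-b)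

%≡%-of-mod : ∀ {a b} n .{{_ : NonZero n}} → + a ≡ + b [mod n ] → a % n ≡ b % n
%≡%-of-mod {a} {b} n a≡b with ≤-total b a
... | inj₁ b≤a = %≡%-of-mod-≤ n b≤a a≡b
... | inj₂ a≤b = sym (%≡%-of-mod-≤ n a≤b (mod-sym a≡b))

n≤2^⌈log2⌉n : ∀ n (acc : Acc _<_ n) → n ≤ 2 ^ ⌈log2⌉ n acc
n≤2^⌈log2⌉n zero          _        = z≤n
n≤2^⌈log2⌉n (suc zero)    _        = s≤s z≤n
n≤2^⌈log2⌉n (suc (suc n)) (acc rs) = begin
    2 + n               ≡⟨ cong (λ x → 2 + x) (⌊n/2⌋+⌈n/2⌉≡n n) ⟨
    2 + (⌊ n /2⌋ + c)   ≤⟨ +-monoʳ-≤ 2 (+-monoˡ-≤ c (⌊n/2⌋≤⌈n/2⌉ n)) ⟩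
    2 + (c + c)         ≡⟨ double c ⟩
    2 * suc c           ≤⟨ *-monoʳ-≤ 2 (n≤2^⌈log2⌉n (suc c) (rs (⌈n/2⌉<n n))) ⟩
    2 * 2 ^ ⌈log2⌉ (suc c) _ ∎
  where
  open ≤-Reasoning
  c = ⌈ n /2⌉
  double : ∀ c → 2 + (c + c) ≡ 2 * suc c
  double = ℕ-Solver.solve-∀

k≤2^[2+b] : ∀ k → 2 < k → k ≤ 2 ^ (2 + b k)
k≤2^[2+b] k 2<k = bound ⌈log₂ k ⌉ (n≤2^⌈log2⌉n k _)
  where
  bound : ∀ c → k ≤ 2 ^ c → k ≤ 2 ^ (2 + (c ∸ 2))
  bound zero          k≤1 = ⊥-elim (<⇒≱ 2<k (≤-trans k≤1 (s≤s z≤n)))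
  bound (suc zero)    k≤2 = ⊥-elim (<⇒≱ 2<k k≤2)
  bound (suc (suc c)) k≤  = k≤

⌈n/2⌉≤2^t : ∀ {n} t → n ≤ 2 ^ suc t → ⌈ n /2⌉ ≤ 2 ^ t
⌈n/2⌉≤2^t {n} t n≤ = ≤-trans (⌈n/2⌉-mono (≤-trans n≤ (≤-reflexive (2^[1+n]≡2^n+2^n t))))
                             (≤-reflexive (sym (n≡⌈n+n/2⌉ (2 ^ t))))

m^n∣m^o : ∀ m {n o} → n ≤ o → m ^ n ∣ m ^ o
m^n∣m^o m {n} {o} n≤o = ℕ.divides (m ^ (o ∸ n)) (begin
    m ^ o                 ≡⟨ cong (m ^_) (m+[n∸m]≡n n≤o) ⟨
    m ^ (n + (o ∸ n))     ≡⟨ ^-distribˡ-+-* m n (o ∸ n) ⟩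
    m ^ n * m ^ (o ∸ n)   ≡⟨ *-comm (m ^ n) _ ⟩
    m ^ (o ∸ n) * m ^ n   ∎)
  where open ≡-Reasoning

2^n*n!∣[n+n]! : ∀ n → 2 ^ n * n ! ∣ (n + n) !
2^n*n!∣[n+n]! zero    = ℕ.∣-refl
2^n*n!∣[n+n]! (suc n) =
  subst₂ _∣_ (sym (left (2 ^ n) (n !) n))
             (trans (right n ((n + n) !)) (cong (λ x → suc x !) (sym (+-suc n n))))
    (ℕ.*-monoʳ-∣ (2 * suc n) (ℕ.∣n⇒∣m*n (suc (n + n)) (2^n*n!∣[n+n]! n)))
  where
  left : ∀ X F n → 2 * X * (suc n * F) ≡ 2 * suc n * (X * F)
  left = ℕ-Solver.solve-∀
  right : ∀ n F → 2 * suc n * (suc (n + n) * F) ≡ suc (suc (n + n)) * (suc (n + n) * F)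
  right = ℕ-Solver.solve-∀

2^[2^n∸1]∣[2^n]! : ∀ n → 2 ^ (2 ^ n ∸ 1) ∣ (2 ^ n) !
2^[2^n∸1]∣[2^n]! zero    = ℕ.∣-refl
2^[2^n∸1]∣[2^n]! (suc n) =
  subst₂ _∣_ (sym exponent) (cong _! (sym (2^[1+n]≡2^n+2^n n)))
    (ℕ.∣-trans (ℕ.*-monoʳ-∣ (2 ^ T) (2^[2^n∸1]∣[2^n]! n)) (2^n*n!∣[n+n]! T))
  where
  T = 2 ^ n
  exponent : 2 ^ (2 ^ suc n ∸ 1) ≡ 2 ^ T * 2 ^ (T ∸ 1)
  exponent = begin
    2 ^ (2 ^ suc n ∸ 1)   ≡⟨ cong (λ x → 2 ^ (x ∸ 1)) (2^[1+n]≡2^n+2^n n) ⟩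
    2 ^ (T + T ∸ 1)       ≡⟨ cong (2 ^_) (+-∸-assoc T (m^n>0 2 n)) ⟩
    2 ^ (T + (T ∸ 1))     ≡⟨ ^-distribˡ-+-* 2 T (T ∸ 1) ⟩
    2 ^ T * 2 ^ (T ∸ 1)   ∎
    where open ≡-Reasoning

IsNu2-maximal : ∀ {z v u} → IsNu2 z v → 2 ^ u ∣ z → u ≤ v
IsNu2-maximal (_ , 2^[1+v]∤z) 2^u∣z = ≮⇒≥ λ v<u → 2^[1+v]∤z (ℕ.∣-trans (m^n∣m^o 2 v<u) 2^u∣z)

n<2^n : ∀ n → n < 2 ^ n
n<2^n zero    = s≤s z≤n
n<2^n (suc n) = +-mono-≤ (m^n>0 2 n) (≤-trans (n<2^n n) (m≤m+n (2 ^ n) 0))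

3+n<2^[2+n] : ∀ n → 3 + n < 2 ^ (2 + n)
3+n<2^[2+n] n = +-mono-≤ (*-monoʳ-≤ 2 (m^n>0 2 n)) (≤-trans (n<2^n (suc n)) (m≤m+n (2 ^ suc n) 0))

[1+d]*a<2^d*T : ∀ d {a T} → 0 < T → a ≤ T → (a ≡ T → d + (T + T) ≤ 2 ^ d * T) →
                suc d * a < 2 ^ d * T
[1+d]*a<2^d*T d {a} {T} 0<T a≤T a≡T⇒ with m≤n⇒m<n∨m≡n a≤T
... | inj₁ a<T = <-≤-trans (*-monoʳ-< (suc d) a<T) (*-monoˡ-≤ T (n<2^n d))
... | inj₂ refl = [1+d]*T<2^d*T d (a≡T⇒ refl)
  where
  [1+d]*T<2^d*T : ∀ d → d + (T + T) ≤ 2 ^ d * T → suc d * T < 2 ^ d * T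
  [1+d]*T<2^d*T zero          2T≤T  = ⊥-elim (<⇒≱ (+-monoʳ-< T 0<T) 2T≤T)
  [1+d]*T<2^d*T (suc zero)    2T<2T =
    ⊥-elim (<⇒≱ (s≤s (≤-reflexive (cong (λ x → T + x) (+-identityʳ T)))) 2T<2T)
  [1+d]*T<2^d*T (suc (suc e)) _     = *-monoˡ-< T {{>-nonZero 0<T}} (3+n<2^[2+n] e)

m∸1≤n⇒m≤1+n : ∀ {m n} → m ∸ 1 ≤ n → m ≤ suc n
m∸1≤n⇒m≤1+n {zero}  _   = z≤n
m∸1≤n⇒m≤1+n {suc m} m≤n = s≤s m≤n

-- Only k = 2^(t+1) could push the threshold to 2^d 2^t; then ν₂(k!) = k − 1 rules out d ≤ 1.
[1+d]*⌊k/2⌋<2^d*2^t : ∀ {k t d v} → k ≤ 2 ^ suc t → IsNu2 (k !) v → suc d + v ≤ 2 ^ d * 2 ^ t →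
                     suc d * ⌊ k /2⌋ < 2 ^ d * 2 ^ t
[1+d]*⌊k/2⌋<2^d*2^t {k} {t} {d} {v} k≤2T ν hyp =
  [1+d]*a<2^d*T d (m^n>0 2 t) (≤-trans (⌊n/2⌋≤⌈n/2⌉ k) (⌈n/2⌉≤2^t t k≤2T)) tight
  where
  T = 2 ^ t
  tight : ⌊ k /2⌋ ≡ T → d + (T + T) ≤ 2 ^ d * T
  tight a≡T = begin
      d + (T + T)    ≡⟨ cong (λ x → d + x) (2^[1+n]≡2^n+2^n t) ⟨
      d + 2 ^ suc t  ≤⟨ +-monoʳ-≤ d (m∸1≤n⇒m≤1+n (IsNu2-maximal ν 2^[2T∸1]∣k!)) ⟩
      d + suc v      ≡⟨ +-suc d v ⟩
      suc d + v      ≤⟨ hyp ⟩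
      2 ^ d * T      ∎
    where
    open ≤-Reasoning
    2T≤k : 2 ^ suc t ≤ k
    2T≤k = begin
      2 ^ suc t                  ≡⟨ 2^[1+n]≡2^n+2^n t ⟩
      T + T                      ≡⟨ cong₂ _+_ a≡T a≡T ⟨
      ⌊ k /2⌋ + ⌊ k /2⌋          ≤⟨ +-monoʳ-≤ ⌊ k /2⌋ (⌊n/2⌋≤⌈n/2⌉ k) ⟩
      ⌊ k /2⌋ + ⌈ k /2⌉          ≡⟨ ⌊n/2⌋+⌈n/2⌉≡n k ⟩
      k                          ∎
    2^[2T∸1]∣k! : 2 ^ (2 ^ suc t ∸ 1) ∣ k !
    2^[2T∸1]∣k! =
      subst (λ x → 2 ^ (2 ^ suc t ∸ 1) ∣ x !) (≤-antisym 2T≤k k≤2T) (2^[2^n∸1]∣[2^n]! (suc t))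

2^[c+1+d]≡2^d*2^[1+c] : ∀ c d → 2 ^ (c + suc d) ≡ 2 ^ d * 2 ^ suc c
2^[c+1+d]≡2^d*2^[1+c] c d =
  trans (cong (2 ^_) (trans (+-comm c (suc d)) (sym (+-suc d c)))) (^-distribˡ-+-* 2 d (suc c))

proposition3p5 : (k m n : ℕ) → n ≥ k → k ≥ 5 → m ≥ b k →
    (v : ℕ) → IsNu2 (k !) v → 2 ^ m ≥ (m ∸ b k) + v →
    (i j : ℕ) → InClass n (2 ^ m) {{m^n≢0 2 m}} i → InClass n (2 ^ m) {{m^n≢0 2 m}} j →
    S i k ≡ S j k [mod2^ (m ∸ b k) ]
proposition3p5 k m n _ k≥5 m≥b v ν 2^m≥e+v i j (_ , 2^m≤i , i≡n) (_ , 2^m≤j , j≡n)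
  with m ∸ b k in m∸b≡e
... | zero  = trans (n%1≡0 (S i k)) (sym (n%1≡0 (S j k)))
... | suc d = %≡%-of-mod (2 ^ suc d) {{m^n≢0 2 (suc d)}}
  (periodicFrom-% {{m^n≢0 2 m}} (stirling-periodic periodic)
    (<-≤-trans J<2^m 2^m≤i) (<-≤-trans J<2^m 2^m≤j) (trans i≡n (sym j≡n)))
  where
  t = suc (b k)
  2^m≡2^d*2^t : 2 ^ m ≡ 2 ^ d * 2 ^ t
  2^m≡2^d*2^t = trans (cong (2 ^_) (trans (sym (m+[n∸m]≡n m≥b)) (cong (λ e → b k + e) m∸b≡e)))
                      (2^[c+1+d]≡2^d*2^[1+c] (b k) d)
  k≤2^[1+t] : k ≤ 2 ^ suc t
  k≤2^[1+t] = k≤2^[2+b] k (≤-trans (s≤s (s≤s (s≤s z≤n))) k≥5)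
  periodic : KernelPeriodic k (suc d * ⌊ k /2⌋) (2 ^ m) (2 ^ suc d)
  periodic = subst (λ T → KernelPeriodic k _ T _) (sym 2^m≡2^d*2^t)
    (kernelPeriodic-iterate (kernelPeriodic-mod2 k t (⌈n/2⌉≤2^t t k≤2^[1+t])) d)
  J<2^m : suc d * ⌊ k /2⌋ < 2 ^ m
  J<2^m = subst (_ <_) (sym 2^m≡2^d*2^t) ([1+d]*⌊k/2⌋<2^d*2^t {k} {t} {d} {v} k≤2^[1+t] ν
    (subst (suc d + v ≤_) 2^m≡2^d*2^t 2^m≥e+v))
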